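{- Let $x$ be an ordinary variable and $S$ a base suspension. Then: (1) for every CPS-value $B$, $\phi(B)[x:=\sigma(S)]=\phi(B[x:=S])$; (2) for every suspension combination $T$, $\sigma(T)[x:=\sigma(S)]=\sigma(T[x:=S])$; (3) for every base computation $C$, $\overline{C}[x:=\sigma(S)]=\overline{C[x:=S]}$; (4) for every continuation $K$ and every term $M$, $\underline{K}[M][x:=\sigma(S)]=\underline{K[x:=S]}[M[x:=\sigma(S)]]$.
   Context: Syntax. Fix a ring of scalars; $\alpha$ ranges over it. Terms: $M,N ::= V \mid MN \mid \alpha.M \mid M+N$; values $V,W ::= B \mid 0 \mid \alpha.V \mid V+W$; base values $B ::= x \mid \lambda x.M$. Terms are taken up to $\alpha$-conversion and $M[x:=N]$ is capture-avoiding substitution. CPS grammar. Base computations $C ::= KB \mid BSK \mid TK$; computation combinations $D ::= C \mid 0 \mid \alpha.D \mid D_1+D_2$; base suspensions $S ::= x \mid \lambda k.C$; suspension combinations $T ::= S \mid 0 \mid \alpha.T \mid T_1+T_2$; continuations $K ::= k \mid \lambda b.bSK$; CPS-values $B ::= \lambda x.S$. Here $x$ ranges over ordinary variables, $k,b$ are reserved variables; $k$ occurs only as the continuation $k$ and as the binder in $\lambda k.C$; $b$ occurs only where displayed. Inverse translation: $\overline{KB}=\underline{K}[\phi(B)]$; $\overline{BSK}=\underline{K}[\phi(B)\sigma(S)]$; $\overline{TK}=\underline{K}[\sigma(T)]$; $\overline{0}=0$; $\overline{\alpha.D}=\alpha.\overline{D}$; $\overline{D_1+D_2}=\overline{D_1}+\overline{D_2}$;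 $\sigma(x)=x$; $\sigma(\lambda k.C)=\overline{C}$; $\sigma(0)=0$; $\sigma(\alpha.T)=\alpha.\sigma(T)$; $\sigma(T_1+T_2)=\sigma(T_1)+\sigma(T_2)$; $\phi(\lambda x.S)=\lambda x.\sigma(S)$; for a term $M$: $\underline{k}[M]=M$; $\underline{\lambda b.bSK}[M]=\underline{K}[M\,\sigma(S)]$. -}

module Defs where

open import Data.Nat using (ℕ; suc)
open import Data.Fin using (Fin; zero; suc; _≟_; punchOut)
open import Relation.Nullary using (yes; no)

-- Ordinary variables are well-scoped de Bruijn indices (Fin n); terms are
-- therefore identified up to α-conversion.  The reserved variables k and b
-- are not ordinary variables: k is the constructor `kvar` (bound by `lamk`),
-- and the b of λb.bSK is built into the constructor `lamb`.

liftR : ∀ {m n} → (Fin m → Fin n) → Fin (suc m) → Fin (suc n)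
liftR ρ zero    = zero
liftR ρ (suc i) = suc (ρ i)

data Term {a} (A : Set a) (n : ℕ) : Set a where
  var  : Fin n → Term A n
  lam  : Term A (suc n) → Term A n
  app  : Term A n → Term A n → Term A n
  zer  : Term A n
  scal : A → Term A n → Term A n
  add  : Term A n → Term A n → Term A n

module _ {a} {A : Set a} where

  renT : ∀ {m n} → (Fin m → Fin n) → Term A m → Term A n
  renT ρ (var i)    = var (ρ i)
  renT ρ (lam M)    = lam (renT (liftR ρ) M)
  renT ρ (app M N)  = app (renT ρ M) (renT ρ N)
  renT ρ zer        = zer
  renT ρ (scal α M) = scal α (renT ρ M)
  renT ρ (add M N)  = add (renT ρ M) (renT ρ N)

  _[_:=_] : ∀ {n} → Term A (suc n) → Fin (suc n) → Term A n → Term A n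
  var y    [ x := N ] with x ≟ y
  ... | yes _ = N
  ... | no ne = var (punchOut ne)
  lam M    [ x := N ] = lam (M [ suc x := renT suc N ])
  app M P  [ x := N ] = app (M [ x := N ]) (P [ x := N ])
  zer      [ x := N ] = zer
  scal α M [ x := N ] = scal α (M [ x := N ])
  add M P  [ x := N ] = add (M [ x := N ]) (P [ x := N ])

data Comp     {a} (A : Set a) (n : ℕ) : Set a
data CompComb {a} (A : Set a) (n : ℕ) : Set a
data Susp     {a} (A : Set a) (n : ℕ) : Set a
data SuspComb {a} (A : Set a) (n : ℕ) : Set a
data Cont     {a} (A : Set a) (n : ℕ) : Set a
data Val      {a} (A : Set a) (n : ℕ) : Set a

data Comp A n where
  kB  : Cont A n → Val A n → Comp A n
  bSK : Val A n → Susp A n → Cont A n → Comp A n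
  tK  : SuspComb A n → Cont A n → Comp A n

data CompComb A n where
  dbase : Comp A n → CompComb A n
  dzer  : CompComb A n
  dscal : A → CompComb A n → CompComb A n
  dadd  : CompComb A n → CompComb A n → CompComb A n

data Susp A n where
  svar : Fin n → Susp A n
  lamk : Comp A n → Susp A n

data SuspComb A n where
  sbase : Susp A n → SuspComb A n
  szer  : SuspComb A n
  sscal : A → SuspComb A n → SuspComb A n
  sadd  : SuspComb A n → SuspComb A n → SuspComb A n

data Cont A n where
  kvar : Cont A n
  lamb : Susp A n → Cont A n → Cont A n

data Val A n where
  lamx : Susp A (suc n) → Val A n

module _ {a} {A : Set a} where

  renC  : ∀ {m n} → (Fin m → Fin n) → Comp A m → Comp A n
  renD  : ∀ {m n} → (Fin m → Fin n) → CompComb A m → CompComb A n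
  renS  : ∀ {m n} → (Fin m → Fin n) → Susp A m → Susp A n
  renTs : ∀ {m n} → (Fin m → Fin n) → SuspComb A m → SuspComb A n
  renK  : ∀ {m n} → (Fin m → Fin n) → Cont A m → Cont A n
  renB  : ∀ {m n} → (Fin m → Fin n) → Val A m → Val A n

  renC ρ (kB K B)    = kB (renK ρ K) (renB ρ B)
  renC ρ (bSK B S K) = bSK (renB ρ B) (renS ρ S) (renK ρ K)
  renC ρ (tK T K)    = tK (renTs ρ T) (renK ρ K)
  renD ρ (dbase C)   = dbase (renC ρ C)
  renD ρ dzer        = dzer
  renD ρ (dscal α D) = dscal α (renD ρ D)
  renD ρ (dadd D E)  = dadd (renD ρ D) (renD ρ E)
  renS ρ (svar i)    = svar (ρ i)
  renS ρ (lamk C)    = lamk (renC ρ C)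
  renTs ρ (sbase S)   = sbase (renS ρ S)
  renTs ρ szer        = szer
  renTs ρ (sscal α T) = sscal α (renTs ρ T)
  renTs ρ (sadd T U)  = sadd (renTs ρ T) (renTs ρ U)
  renK ρ kvar        = kvar
  renK ρ (lamb S K)  = lamb (renS ρ S) (renK ρ K)
  renB ρ (lamx S)    = lamx (renS (liftR ρ) S)

  subC  : ∀ {n} → Comp A (suc n) → Fin (suc n) → Susp A n → Comp A n
  subD  : ∀ {n} → CompComb A (suc n) → Fin (suc n) → Susp A n → CompComb A n
  subS  : ∀ {n} → Susp A (suc n) → Fin (suc n) → Susp A n → Susp A n
  subTs : ∀ {n} → SuspComb A (suc n) → Fin (suc n) → Susp A n → SuspComb A n
  subK  : ∀ {n} → Cont A (suc n) → Fin (suc n) → Susp A n → Cont A n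
  subB  : ∀ {n} → Val A (suc n) → Fin (suc n) → Susp A n → Val A n

  subC (kB K B)    x S = kB (subK K x S) (subB B x S)
  subC (bSK B S' K) x S = bSK (subB B x S) (subS S' x S) (subK K x S)
  subC (tK T K)    x S = tK (subTs T x S) (subK K x S)
  subD (dbase C)   x S = dbase (subC C x S)
  subD dzer        x S = dzer
  subD (dscal α D) x S = dscal α (subD D x S)
  subD (dadd D E)  x S = dadd (subD D x S) (subD E x S)
  subS (svar y)    x S with x ≟ y
  ... | yes _ = S
  ... | no ne = svar (punchOut ne)
  subS (lamk C)    x S = lamk (subC C x S)
  subTs (sbase S')  x S = sbase (subS S' x S)
  subTs szer        x S = szer
  subTs (sscal α T) x S = sscal α (subTs T x S)
  subTs (sadd T U)  x S = sadd (subTs T x S) (subTs U x S)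
  subK kvar         x S = kvar
  subK (lamb S' K)  x S = lamb (subS S' x S) (subK K x S)
  subB (lamx S')    x S = lamx (subS S' (suc x) (renS suc S))

  bar   : ∀ {n} → Comp A n → Term A n
  barD  : ∀ {n} → CompComb A n → Term A n
  σS    : ∀ {n} → Susp A n → Term A n
  σ     : ∀ {n} → SuspComb A n → Term A n
  φ     : ∀ {n} → Val A n → Term A n
  under : ∀ {n} → Cont A n → Term A n → Term A n

  bar (kB K B)    = under K (φ B)
  bar (bSK B S K) = under K (app (φ B) (σS S))
  bar (tK T K)    = under K (σ T)
  barD (dbase C)   = bar C
  barD dzer        = zer
  barD (dscal α D) = scal α (barD D)
  barD (dadd D E)  = add (barD D) (barD E)
  σS (svar x)  = var x
  σS (lamk C)  = bar C
  σ (sbase S)   = σS S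
  σ szer        = zer
  σ (sscal α T) = scal α (σ T)
  σ (sadd T U)  = add (σ T) (σ U)
  φ (lamx S) = lam (σS S)
  under kvar M       = M
  under (lamb S K) M = under K (app M (σS S))

module Submission where

-- The
-- proof is a simultaneous structural induction over the mutually defined CPS
-- syntax (values, suspensions, computations, continuations): every clause of
-- the inverse translation is built from term constructors that commute with
-- substitution, so each case follows from the induction hypotheses.
--
-- The single non-structural case is the CPS-value λx.S', whose body is
-- substituted under a binder with the weakened suspension renS suc S.  To
-- match the source side, which weakens σ(S) by renT suc, we first prove that
-- the inverse translation commutes with arbitrary renamings; this is the
-- same kind of simultaneous induction.
--
-- Neither fact uses the ring structure of the scalars, so both are proved
-- for an arbitrary scalar type; the theorem is their instance at a ring.

open import Defs
open import Data.Nat using (ℕ; suc)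
open import Data.Fin using (Fin; _≟_)
import Data.Fin as Fin
open import Data.Product using (_×_; _,_)
open import Relation.Binary.PropositionalEquality using (_≡_; refl; cong; cong₂; module ≡-Reasoning)
open import Relation.Nullary using (yes; no)
open import Algebra.Bundles using (Ring)

module InverseTranslation {a} {A : Set a} where

  open ≡-Reasoning

  ren-σS  : ∀ {m n} (ρ : Fin m → Fin n) (S : Susp A m) →
            renT ρ (σS S) ≡ σS (renS ρ S)
  ren-σ   : ∀ {m n} (ρ : Fin m → Fin n) (T : SuspComb A m) →
            renT ρ (σ T) ≡ σ (renTs ρ T)
  ren-bar : ∀ {m n} (ρ : Fin m → Fin n) (C : Comp A m) →
            renT ρ (bar C) ≡ bar (renC ρ C)
  ren-φ   : ∀ {m n} (ρ : Fin m → Fin n) (B : Val A m) →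
            renT ρ (φ B) ≡ φ (renB ρ B)
  ren-under : ∀ {m n} (ρ : Fin m → Fin n) (K : Cont A m) (M : Term A m) →
              renT ρ (under K M) ≡ under (renK ρ K) (renT ρ M)

  ren-σS ρ (svar y) = refl
  ren-σS ρ (lamk C) = ren-bar ρ C

  ren-σ ρ (sbase S)   = ren-σS ρ S
  ren-σ ρ szer        = refl
  ren-σ ρ (sscal α T) = cong (scal α) (ren-σ ρ T)
  ren-σ ρ (sadd T U)  = cong₂ add (ren-σ ρ T) (ren-σ ρ U)

  ren-bar ρ (kB K B) = begin
    renT ρ (under K (φ B))             ≡⟨ ren-under ρ K (φ B) ⟩
    under (renK ρ K) (renT ρ (φ B))    ≡⟨ cong (under (renK ρ K)) (ren-φ ρ B) ⟩
    under (renK ρ K) (φ (renB ρ B))    ∎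
  ren-bar ρ (bSK B S K) = begin
    renT ρ (under K (app (φ B) (σS S)))
      ≡⟨ ren-under ρ K (app (φ B) (σS S)) ⟩
    under (renK ρ K) (app (renT ρ (φ B)) (renT ρ (σS S)))
      ≡⟨ cong (under (renK ρ K)) (cong₂ app (ren-φ ρ B) (ren-σS ρ S)) ⟩
    under (renK ρ K) (app (φ (renB ρ B)) (σS (renS ρ S)))
      ∎
  ren-bar ρ (tK T K) = begin
    renT ρ (under K (σ T))             ≡⟨ ren-under ρ K (σ T) ⟩
    under (renK ρ K) (renT ρ (σ T))    ≡⟨ cong (under (renK ρ K)) (ren-σ ρ T) ⟩
    under (renK ρ K) (σ (renTs ρ T))   ∎

  ren-φ ρ (lamx S) = cong lam (ren-σS (liftR ρ) S)

  ren-under ρ kvar       M = refl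
  ren-under ρ (lamb S K) M = begin
    renT ρ (under K (app M (σS S)))
      ≡⟨ ren-under ρ K (app M (σS S)) ⟩
    under (renK ρ K) (app (renT ρ M) (renT ρ (σS S)))
      ≡⟨ cong (λ N → under (renK ρ K) (app (renT ρ M) N)) (ren-σS ρ S) ⟩
    under (renK ρ K) (app (renT ρ M) (σS (renS ρ S)))
      ∎

  weaken-σS : ∀ {n} (S : Susp A n) → renT Fin.suc (σS S) ≡ σS (renS Fin.suc S)
  weaken-σS = ren-σS Fin.suc

  sub-σS  : ∀ {n} (x : Fin (suc n)) (S : Susp A n) (S' : Susp A (suc n)) →
            σS S' [ x := σS S ] ≡ σS (subS S' x S)
  sub-σ   : ∀ {n} (x : Fin (suc n)) (S : Susp A n) (T : SuspComb A (suc n)) →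
            σ T [ x := σS S ] ≡ σ (subTs T x S)
  sub-bar : ∀ {n} (x : Fin (suc n)) (S : Susp A n) (C : Comp A (suc n)) →
            bar C [ x := σS S ] ≡ bar (subC C x S)
  sub-under : ∀ {n} (x : Fin (suc n)) (S : Susp A n) (K : Cont A (suc n)) (M : Term A (suc n)) →
              under K M [ x := σS S ] ≡ under (subK K x S) (M [ x := σS S ])
  sub-φ   : ∀ {n} (x : Fin (suc n)) (S : Susp A n) (B : Val A (suc n)) →
            φ B [ x := σS S ] ≡ φ (subB B x S)

  -- Variables: both substitutions make the same decision x ≟ y, and
  -- produce σ(S), resp. the same punched-out variable.
  sub-σS x S (svar y) with x ≟ y
  ... | yes _ = refl
  ... | no  _ = refl
  sub-σS x S (lamk C) = sub-bar x S C

  sub-σ x S (sbase S')  = sub-σS x S S'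
  sub-σ x S szer        = refl
  sub-σ x S (sscal α T) = cong (scal α) (sub-σ x S T)
  sub-σ x S (sadd T U)  = cong₂ add (sub-σ x S T) (sub-σ x S U)

  sub-bar x S (kB K B) = begin
    under K (φ B) [ x := σS S ]                 ≡⟨ sub-under x S K (φ B) ⟩
    under (subK K x S) (φ B [ x := σS S ])      ≡⟨ cong (under (subK K x S)) (sub-φ x S B) ⟩
    under (subK K x S) (φ (subB B x S))         ∎
  sub-bar x S (bSK B S' K) = begin
    under K (app (φ B) (σS S')) [ x := σS S ]
      ≡⟨ sub-under x S K (app (φ B) (σS S')) ⟩
    under (subK K x S) (app (φ B [ x := σS S ]) (σS S' [ x := σS S ]))
      ≡⟨ cong (under (subK K x S)) (cong₂ app (sub-φ x S B) (sub-σS x S S')) ⟩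
    under (subK K x S) (app (φ (subB B x S)) (σS (subS S' x S)))
      ∎
  sub-bar x S (tK T K) = begin
    under K (σ T) [ x := σS S ]                 ≡⟨ sub-under x S K (σ T) ⟩
    under (subK K x S) (σ T [ x := σS S ])      ≡⟨ cong (under (subK K x S)) (sub-σ x S T) ⟩
    under (subK K x S) (σ (subTs T x S))        ∎

  sub-under x S kvar        M = refl
  sub-under x S (lamb S' K) M = begin
    under K (app M (σS S')) [ x := σS S ]
      ≡⟨ sub-under x S K (app M (σS S')) ⟩
    under (subK K x S) (app (M [ x := σS S ]) (σS S' [ x := σS S ]))
      ≡⟨ cong (λ N → under (subK K x S) (app (M [ x := σS S ]) N)) (sub-σS x S S') ⟩
    under (subK K x S) (app (M [ x := σS S ]) (σS (subS S' x S)))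
      ∎

  -- CPS-values λx.S': under the binder the source side substitutes the
  -- weakened term renT suc (σ(S)), the CPS side the weakened suspension
  -- renS suc S; weakening reconciles the two, after which the suspension
  -- case applies one scope level up.
  sub-φ x S (lamx S') = cong lam (begin
    σS S' [ Fin.suc x := renT Fin.suc (σS S) ]
      ≡⟨ cong (λ N → σS S' [ Fin.suc x := N ]) (weaken-σS S) ⟩
    σS S' [ Fin.suc x := σS (renS Fin.suc S) ]
      ≡⟨ sub-σS (Fin.suc x) (renS Fin.suc S) S' ⟩
    σS (subS S' (Fin.suc x) (renS Fin.suc S))
      ∎)

lemma4p8 : ∀ {c ℓ} (R : Ring c ℓ) {n : ℕ} (x : Fin (suc n)) (S : Susp (Ring.Carrier R) n) →
    (∀ (B : Val (Ring.Carrier R) (suc n)) → φ B [ x := σS S ] ≡ φ (subB B x S))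
    × (∀ (T : SuspComb (Ring.Carrier R) (suc n)) → σ T [ x := σS S ] ≡ σ (subTs T x S))
    × (∀ (C : Comp (Ring.Carrier R) (suc n)) → bar C [ x := σS S ] ≡ bar (subC C x S))
    × (∀ (K : Cont (Ring.Carrier R) (suc n)) (M : Term (Ring.Carrier R) (suc n)) →
    under K M [ x := σS S ] ≡ under (subK K x S) (M [ x := σS S ]))
lemma4p8 R x S = sub-φ x S , sub-σ x S , sub-bar x S , sub-under x S
  where open InverseTranslation
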